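{- Let $G$ be a $(P_2\cup P_3)$-free graph, $S\subseteq V(G)$ a cutset of $G$, and $x\in S$. Suppose that $x$ is adjacent to exactly one component $D$ of $G-S$, and that $G-S$ has a nontrivial component to which $x$ is not adjacent. Then $x$ is adjacent in $G$ to all vertices of $D$.
   Context: Graphs are finite, simple, undirected. A cutset of $G$ is a set $S\subseteq V(G)$ such that $G-S$ (the subgraph induced on $V(G)\setminus S$) has at least two components. For $x\in S$ and a component $D$ of $G-S$, $x$ is adjacent to $D$ if $x$ is adjacent in $G$ to some vertex of $D$. A component is trivial if it has exactly one vertex, nontrivial otherwise. A graph is $(P_2\cup P_3)$-free if it has no induced subgraph isomorphic to the disjoint union of a path on 2 vertices and a path on 3 vertices. -}

module Defs where

open import Data.Nat using (ℕ)
open import Data.Fin using (Fin)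
open import Data.Fin.Subset using (Subset; _∈_; _∉_)
open import Data.Product using (Σ; ∃; ∃-syntax; _×_; _,_)
open import Relation.Nullary using (¬_; Dec)
open import Relation.Binary.PropositionalEquality using (_≡_; _≢_)

record Graph (n : ℕ) : Set₁ where
  field
    Adj    : Fin n → Fin n → Set
    adj?   : ∀ u v → Dec (Adj u v)
    sym    : ∀ {u v} → Adj u v → Adj v u
    irrefl : ∀ {u} → ¬ Adj u u

module _ {n : ℕ} (G : Graph n) where
  open Graph G

  -- G contains an induced P2 ∪ P3: edge a–b, path c–d–e (c, e non-adjacent,
  -- c ≠ e), and no edges between {a,b} and {c,d,e}.
  -- (All five vertices are then automatically distinct.)
  HasInducedP2∪P3 : Set
  HasInducedP2∪P3 =
    Σ (Fin n) λ a → Σ (Fin n) λ b → Σ (Fin n) λ c → Σ (Fin n) λ d → Σ (Fin n) λ e →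
      Adj a b × Adj c d × Adj d e × ¬ Adj c e × c ≢ e ×
      ¬ Adj a c × ¬ Adj a d × ¬ Adj a e × ¬ Adj b c × ¬ Adj b d × ¬ Adj b e

  P2∪P3-free : Set
  P2∪P3-free = ¬ HasInducedP2∪P3

  data Conn (S : Subset n) : Fin n → Fin n → Set where
    here : ∀ {u} → u ∉ S → Conn S u u
    step : ∀ {u v w} → u ∉ S → Adj u v → Conn S v w → Conn S u w

  -- The component of G - S containing v (v ∉ S) is { w | Conn S v w }.
  -- x is adjacent to the component of G - S containing v.
  AdjComp : Subset n → Fin n → Fin n → Set
  AdjComp S x v = ∃[ w ] (Conn S v w × Adj x w)

  NontrivialComp : Subset n → Fin n → Set
  NontrivialComp S v = ∃[ w ] (w ≢ v × Conn S v w)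

  Cutset : Subset n → Set
  Cutset S = ∃[ u ] ∃[ w ] (u ∉ S × w ∉ S × ¬ Conn S u w)

-- Let v – v₁ be an edge in a component of G − S that x does not see. If x saw some
-- u ∈ D but not a neighbour u₁ of u in G − S, then v – v₁ together with x – u – u₁
-- would be an induced P₂ ∪ P₃: every edge between the two paths would join x's
-- neighbourhood to the component of v. So x's neighbourhood in G − S is closed under
-- edges of G − S and therefore contains all of D.
module Submission where

open import Defs
open import Data.Nat using (ℕ)
open import Data.Fin using (Fin)
open import Data.Fin.Subset using (Subset; _∈_; _∉_)
open import Data.Product using (∃-syntax; _×_; _,_)
open import Data.Empty using (⊥-elim)
open import Relation.Nullary using (¬_; yes; no)
open import Relation.Binary.PropositionalEquality using (refl; subst)

module _ {n : ℕ} (G : Graph n) where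
  open Graph G

  Conn-start∉ : ∀ {S u w} → Conn G S u w → u ∉ S
  Conn-start∉ (here u∉S)     = u∉S
  Conn-start∉ (step u∉S _ _) = u∉S

  Conn-snoc : ∀ {S u v w} → Conn G S u v → Adj v w → w ∉ S → Conn G S u w
  Conn-snoc (here v∉S)     vw w∉S = step v∉S vw (here w∉S)
  Conn-snoc (step u∉S a r) vw w∉S = step u∉S a (Conn-snoc r vw w∉S)

  Conn-sym : ∀ {S u w} → Conn G S u w → Conn G S w u
  Conn-sym (here u∉S)      = here u∉S
  Conn-sym (step u∉S uv r) = Conn-snoc (Conn-sym r) (sym uv) u∉S

  Conn-trans : ∀ {S u v w} → Conn G S u v → Conn G S v w → Conn G S u w
  Conn-trans (here _)        s = s
  Conn-trans (step u∉S uv r) s = step u∉S uv (Conn-trans r s)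

  Conn-preserves : ∀ {S} (P : Fin n → Set) →
    (∀ {u w} → u ∉ S → w ∉ S → Adj u w → P u → P w) →
    ∀ {u t} → Conn G S u t → P u → P t
  Conn-preserves P closed (here _)        pu = pu
  Conn-preserves P closed (step u∉S uv r) pu =
    Conn-preserves P closed r (closed u∉S (Conn-start∉ r) uv pu)

  nontrivial⇒edge : ∀ {S v} → NontrivialComp G S v → ∃[ v₁ ] (Adj v v₁ × v₁ ∉ S)
  nontrivial⇒edge (w , w≢v , here _)        = ⊥-elim (w≢v refl)
  nontrivial⇒edge (w , w≢v , step _ vv₁ r) = _ , vv₁ , Conn-start∉ r

  module _ (free : P2∪P3-free G) {S : Subset n} {x : Fin n} (x∈S : x ∈ S)
           {v v₁ : Fin n} (v∉S : v ∉ S) (vv₁ : Adj v v₁) (v₁∉S : v₁ ∉ S)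
           (x≁compv : ¬ AdjComp G S x v) where

    neighbourhood-closed : ∀ {u u₁} → u ∉ S → u₁ ∉ S → Adj u u₁ → Adj x u → Adj x u₁
    neighbourhood-closed {u} {u₁} u∉S u₁∉S uu₁ xu with adj? x u₁
    ... | yes xu₁ = xu₁
    ... | no  x≁u₁ = ⊥-elim (free
      ( v , v₁ , x , u , u₁ , vv₁ , xu , uu₁ , x≁u₁
      , (λ x≡u₁ → u₁∉S (subst (_∈ S) x≡u₁ x∈S))
      , (λ vx → x≁ v⇝v (sym vx))
      , (λ vu → u-outside v⇝v vu)
      , (λ vu₁ → u-outside (Conn-snoc v⇝v vu₁ u₁∉S) (sym uu₁))
      , (λ v₁x → x≁ v⇝v₁ (sym v₁x))
      , (λ v₁u → u-outside v⇝v₁ v₁u)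
      , (λ v₁u₁ → u-outside (Conn-snoc v⇝v₁ v₁u₁ u₁∉S) (sym uu₁))))
      where
      v⇝v : Conn G S v v
      v⇝v = here v∉S

      v⇝v₁ : Conn G S v v₁
      v⇝v₁ = step v∉S vv₁ (here v₁∉S)

      x≁ : ∀ {y} → Conn G S v y → ¬ Adj x y
      x≁ v⇝y xy = x≁compv (_ , v⇝y , xy)

      u-outside : ∀ {y} → Conn G S v y → ¬ Adj y u
      u-outside v⇝y yu = x≁ (Conn-snoc v⇝y yu u∉S) xu

lemma2p4 : ∀ {n} (G : Graph n) → P2∪P3-free G →
    (S : Subset n) → Cutset G S → (x : Fin n) → x ∈ S →
    (d : Fin n) → d ∉ S → AdjComp G S x d →
    (∀ v → v ∉ S → AdjComp G S x v → Conn G S d v) →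
    (∃[ v ] (v ∉ S × NontrivialComp G S v × ¬ AdjComp G S x v)) →
    ∀ w → Conn G S d w → Graph.Adj G x w
lemma2p4 G free S _ x x∈S d _ (w₀ , d⇝w₀ , xw₀) _ (v , v∉S , nontrivial , x≁compv) w d⇝w
  with nontrivial⇒edge G nontrivial
... | v₁ , vv₁ , v₁∉S =
  Conn-preserves G (Graph.Adj G x)
    (neighbourhood-closed G free x∈S v∉S vv₁ v₁∉S x≁compv)
    (Conn-trans G (Conn-sym G d⇝w₀) d⇝w) xw₀
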